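{- Let $A_1,\dots,A_{10}\in\mathbb{Q}$ and define the quadratic forms in variables $X,Y,Z,W,M,N$: $F_x = A_1X^2+A_2YW+A_3ZM+A_4XW+A_5XM+A_6XY+A_7YM+A_8XZ+A_9ZW+A_{10}XN$, $F_y = A_1XW+A_2Y^2+A_3ZN+A_4XY+A_5XN+A_6YW+A_7YN+A_8ZW+A_9YZ+A_{10}YM$, $F_z = A_1XM+A_2YN+A_3Z^2+A_4XN+A_5XZ+A_6YM+A_7YZ+A_8ZM+A_9ZN+A_{10}ZW$. Let $\Sigma$ denote the system $F_x=0,\ F_y=0,\ F_z=0,\ WM-XN=0,\ MN-ZW=0,\ WN-YM=0,\ W^2-XY=0,\ M^2-XZ=0,\ N^2-YZ=0$. Then $\Sigma$ has a common nontrivial rational solution $(X_0,Y_0,Z_0,W_0,M_0,N_0)$ with $X_0Y_0Z_0\neq0$ if and only if the system obtained from $\Sigma$ by deleting the equation $W^2-XY=0$ has a common nontrivial rational solution $(X_0,Y_0,Z_0,W_0,M_0,N_0)$ with $X_0Y_0Z_0\neq0$. The same statement holds with $M^2-XZ=0$, or with $N^2-YZ=0$, being the deleted equation instead of $W^2-XY=0$.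
   Context: A solution is nontrivial if at least one of its components is nonzero. -}

module Defs where

open import Data.Rational using (ℚ; 0ℚ; _+_; _*_; _-_)
open import Data.Fin using (Fin; zero; suc)
open import Data.Product using (_×_; Σ; ∃)
open import Data.Sum using (_⊎_)
open import Relation.Binary.PropositionalEquality using (_≡_; _≢_)

record Pt : Set where
  constructor pt
  field X Y Z W M N : ℚ
open Pt public

Coeffs : Set
Coeffs = Fin 10 → ℚ

A₁ A₂ A₃ A₄ A₅ A₆ A₇ A₈ A₉ A₁₀ : Coeffs → ℚ
A₁ a = a zero
A₂ a = a (suc zero)
A₃ a = a (suc (suc zero))
A₄ a = a (suc (suc (suc zero)))
A₅ a = a (suc (suc (suc (suc zero))))
A₆ a = a (suc (suc (suc (suc (suc zero)))))
A₇ a = a (suc (suc (suc (suc (suc (suc zero))))))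
A₈ a = a (suc (suc (suc (suc (suc (suc (suc zero)))))))
A₉ a = a (suc (suc (suc (suc (suc (suc (suc (suc zero))))))))
A₁₀ a = a (suc (suc (suc (suc (suc (suc (suc (suc (suc zero)))))))))

Fx Fy Fz : Coeffs → Pt → ℚ
Fx a (pt X Y Z W M N) =
  A₁ a * (X * X) + A₂ a * (Y * W) + A₃ a * (Z * M) + A₄ a * (X * W)
  + A₅ a * (X * M) + A₆ a * (X * Y) + A₇ a * (Y * M) + A₈ a * (X * Z)
  + A₉ a * (Z * W) + A₁₀ a * (X * N)
Fy a (pt X Y Z W M N) =
  A₁ a * (X * W) + A₂ a * (Y * Y) + A₃ a * (Z * N) + A₄ a * (X * Y)
  + A₅ a * (X * N) + A₆ a * (Y * W) + A₇ a * (Y * N) + A₈ a * (Z * W)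
  + A₉ a * (Y * Z) + A₁₀ a * (Y * M)
Fz a (pt X Y Z W M N) =
  A₁ a * (X * M) + A₂ a * (Y * N) + A₃ a * (Z * Z) + A₄ a * (X * N)
  + A₅ a * (X * Z) + A₆ a * (Y * M) + A₇ a * (Y * Z) + A₈ a * (Z * M)
  + A₉ a * (Z * N) + A₁₀ a * (Z * W)

Core : Coeffs → Pt → Set
Core a p@(pt X Y Z W M N) =
  Fx a p ≡ 0ℚ × Fy a p ≡ 0ℚ × Fz a p ≡ 0ℚ
  × W * M - X * N ≡ 0ℚ × M * N - Z * W ≡ 0ℚ × W * N - Y * M ≡ 0ℚ

EqW EqM EqN : Pt → Set
EqW (pt X Y Z W M N) = W * W - X * Y ≡ 0ℚ
EqM (pt X Y Z W M N) = M * M - X * Z ≡ 0ℚ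
EqN (pt X Y Z W M N) = N * N - Y * Z ≡ 0ℚ

SysΣ : Coeffs → Pt → Set
SysΣ a p = Core a p × EqW p × EqM p × EqN p

SysNoW SysNoM SysNoN : Coeffs → Pt → Set
SysNoW a p = Core a p × EqM p × EqN p
SysNoM a p = Core a p × EqW p × EqN p
SysNoN a p = Core a p × EqW p × EqM p

Nontrivial : Pt → Set
Nontrivial (pt X Y Z W M N) =
  X ≢ 0ℚ ⊎ Y ≢ 0ℚ ⊎ Z ≢ 0ℚ ⊎ W ≢ 0ℚ ⊎ M ≢ 0ℚ ⊎ N ≢ 0ℚ

HasSol : (Pt → Set) → Set
HasSol S = Σ Pt λ p → S p × Nontrivial p × X p * Y p * Z p ≢ 0ℚ

{-# OPTIONS --safe #-}
-- Only the three binomial equations WM = XN, MN = ZW, WN = YM and the two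
-- surviving squares matter.  For instance, squaring WM = XN and substituting
-- M² = XZ, N² = YZ gives W²·XZ = X²·YZ, and XZ ≠ 0 may be cancelled to give
-- W² = XY; the other two deleted equations are recovered in the same way.
module Submission where

open import Defs
open import Data.Product using (_×_; _,_)
open import Data.Rational using (0ℚ; 1ℚ; _*_; _-_; 1/_; ≢-nonZero)
open import Data.Rational.Properties
  using (_≟_; +-0-group; +-*-commutativeRing; heytingCommutativeRing;
         *-comm; *-assoc; *-identityˡ; *-inverseˡ; *-zeroˡ; *-zeroʳ)
open import Algebra.Properties.Group +-0-group using (x∙y⁻¹≈ε⇒x≈y; x≈y⇒x∙y⁻¹≈ε)
open import Algebra.Apartness.Properties.HeytingCommutativeRing heytingCommutativeRing
  using (x#0y#0→xy#0)
open import Function.Bundles using (_⇔_; mk⇔)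
open import Relation.Binary.PropositionalEquality
open import Relation.Nullary.Decidable using (dec⇒maybe)
open import Tactic.RingSolver using (solve-∀)
open import Tactic.RingSolver.Core.AlmostCommutativeRing
  using (AlmostCommutativeRing; fromCommutativeRing)

open ≡-Reasoning

ℚ-ring : AlmostCommutativeRing _ _
ℚ-ring = fromCommutativeRing +-*-commutativeRing (λ x → dec⇒maybe (0ℚ ≟ x))

p-q≡0⇒p≡q : ∀ {p q} → p - q ≡ 0ℚ → p ≡ q
p-q≡0⇒p≡q = x∙y⁻¹≈ε⇒x≈y _ _

p≡q⇒p-q≡0 : ∀ {p q} → p ≡ q → p - q ≡ 0ℚ
p≡q⇒p-q≡0 = x≈y⇒x∙y⁻¹≈ε

p*q≢0⇒p≢0 : ∀ p q → p * q ≢ 0ℚ → p ≢ 0ℚ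
p*q≢0⇒p≢0 p q pq≢0 refl = pq≢0 (*-zeroˡ q)

p*q≢0⇒q≢0 : ∀ p q → p * q ≢ 0ℚ → q ≢ 0ℚ
p*q≢0⇒q≢0 p q pq≢0 refl = pq≢0 (*-zeroʳ p)

p*q*r≢0⇒p≢0∧q≢0∧r≢0 : ∀ p q r → p * q * r ≢ 0ℚ → p ≢ 0ℚ × q ≢ 0ℚ × r ≢ 0ℚ
p*q*r≢0⇒p≢0∧q≢0∧r≢0 p q r pqr≢0 =
  p*q≢0⇒p≢0 p q pq≢0 , p*q≢0⇒q≢0 p q pq≢0 , p*q≢0⇒q≢0 (p * q) r pqr≢0
  where
  pq≢0 : p * q ≢ 0ℚ
  pq≢0 = p*q≢0⇒p≢0 (p * q) r pqr≢0

*-cancelˡ-≡ : ∀ c {a b} → c ≢ 0ℚ → c * a ≡ c * b → a ≡ b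
*-cancelˡ-≡ c {a} {b} c≢0 ca≡cb = begin
  a                ≡⟨ sym (*-identityˡ a) ⟩
  1ℚ * a           ≡⟨ cong (_* a) (sym (*-inverseˡ c)) ⟩
  (1/ c) * c * a   ≡⟨ *-assoc (1/ c) c a ⟩
  (1/ c) * (c * a) ≡⟨ cong ((1/ c) *_) ca≡cb ⟩
  (1/ c) * (c * b) ≡⟨ *-assoc (1/ c) c b ⟨
  (1/ c) * c * b   ≡⟨ cong (_* b) (*-inverseˡ c) ⟩
  1ℚ * b           ≡⟨ *-identityˡ b ⟩
  b                ∎
  where instance _ = ≢-nonZero c≢0

uv≡pq∧v²≡ps∧q²≡ts⇒u²≡pt : ∀ u v p q s t → p * s ≢ 0ℚ →
  u * v ≡ p * q → v * v ≡ p * s → q * q ≡ t * s → u * u ≡ p * t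
uv≡pq∧v²≡ps∧q²≡ts⇒u²≡pt u v p q s t ps≢0 uv≡pq v²≡ps q²≡ts =
  *-cancelˡ-≡ (p * s) ps≢0 (begin
    p * s * (u * u)     ≡⟨ cong (_* (u * u)) v²≡ps ⟨
    v * v * (u * u)     ≡⟨ *-comm (v * v) (u * u) ⟩
    u * u * (v * v)     ≡⟨ square-of-* u v ⟩
    (u * v) * (u * v)   ≡⟨ cong₂ _*_ uv≡pq uv≡pq ⟩
    (p * q) * (p * q)   ≡⟨ square-of-* p q ⟨
    p * p * (q * q)     ≡⟨ cong (p * p *_) q²≡ts ⟩
    p * p * (t * s)     ≡⟨ regroup p s t ⟩
    p * s * (p * t)     ∎)
  where
  square-of-* : ∀ x y → x * x * (y * y) ≡ (x * y) * (x * y)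
  square-of-* = solve-∀ ℚ-ring
  regroup : ∀ x y z → x * x * (z * y) ≡ x * y * (x * z)
  regroup = solve-∀ ℚ-ring

SysNoW⇒EqW : ∀ a p → X p * Y p * Z p ≢ 0ℚ → SysNoW a p → EqW p
SysNoW⇒EqW _ (pt X Y Z W M N) xyz≢0 ((_ , _ , _ , wm , _ , _) , m² , n²) =
  let (X≢0 , _ , Z≢0) = p*q*r≢0⇒p≢0∧q≢0∧r≢0 X Y Z xyz≢0 in
  p≡q⇒p-q≡0 (uv≡pq∧v²≡ps∧q²≡ts⇒u²≡pt W M X N Z Y (x#0y#0→xy#0 X≢0 Z≢0)
    (p-q≡0⇒p≡q wm) (p-q≡0⇒p≡q m²) (p-q≡0⇒p≡q n²))

SysNoM⇒EqM : ∀ a p → X p * Y p * Z p ≢ 0ℚ → SysNoM a p → EqM p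
SysNoM⇒EqM _ (pt X Y Z W M N) xyz≢0 ((_ , _ , _ , wm , _ , _) , w² , n²) =
  let (X≢0 , Y≢0 , _) = p*q*r≢0⇒p≢0∧q≢0∧r≢0 X Y Z xyz≢0 in
  p≡q⇒p-q≡0 (uv≡pq∧v²≡ps∧q²≡ts⇒u²≡pt M W X N Y Z (x#0y#0→xy#0 X≢0 Y≢0)
    (trans (*-comm M W) (p-q≡0⇒p≡q wm))
    (p-q≡0⇒p≡q w²)
    (trans (p-q≡0⇒p≡q n²) (*-comm Y Z)))

SysNoN⇒EqN : ∀ a p → X p * Y p * Z p ≢ 0ℚ → SysNoN a p → EqN p
SysNoN⇒EqN _ (pt X Y Z W M N) xyz≢0 ((_ , _ , _ , _ , _ , wn) , w² , m²) =
  let (X≢0 , Y≢0 , _) = p*q*r≢0⇒p≢0∧q≢0∧r≢0 X Y Z xyz≢0 in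
  p≡q⇒p-q≡0 (uv≡pq∧v²≡ps∧q²≡ts⇒u²≡pt N W Y M X Z (x#0y#0→xy#0 Y≢0 X≢0)
    (trans (*-comm N W) (p-q≡0⇒p≡q wn))
    (trans (p-q≡0⇒p≡q w²) (*-comm X Y))
    (trans (p-q≡0⇒p≡q m²) (*-comm X Z)))

HasSol-map : ∀ {S T : Pt → Set} →
  (∀ p → X p * Y p * Z p ≢ 0ℚ → S p → T p) → HasSol S → HasSol T
HasSol-map f (p , Sp , nontrivial , xyz≢0) = p , f p xyz≢0 Sp , nontrivial , xyz≢0

proposition3p5 : (a : Coeffs) →
    (HasSol (SysΣ a) ⇔ HasSol (SysNoW a))
    × (HasSol (SysΣ a) ⇔ HasSol (SysNoM a))
    × (HasSol (SysΣ a) ⇔ HasSol (SysNoN a))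
proposition3p5 a =
    mk⇔ (HasSol-map λ _ _ (core , _ , m² , n²) → core , m² , n²)
        (HasSol-map λ p xyz≢0 s@(core , m² , n²) →
           core , SysNoW⇒EqW a p xyz≢0 s , m² , n²)
  , mk⇔ (HasSol-map λ _ _ (core , w² , _ , n²) → core , w² , n²)
        (HasSol-map λ p xyz≢0 s@(core , w² , n²) →
           core , w² , SysNoM⇒EqM a p xyz≢0 s , n²)
  , mk⇔ (HasSol-map λ _ _ (core , w² , m² , _) → core , w² , m²)
        (HasSol-map λ p xyz≢0 s@(core , w² , m²) →
           core , w² , m² , SysNoN⇒EqN a p xyz≢0 s)
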